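{- Let $D=(V,A)$ be an acyclic digraph and let $F\subseteq V$. Then every nonempty set output by the procedure $\mathrm{CS}(D,F)$ (described in the context) is a convex set of $D$.
   Context: A set $X$ of vertices of an acyclic digraph $D$ is convex if $X\neq\emptyset$ and there is no directed path between two vertices of $X$ containing a vertex not in $X$. A vertex is a source (sink) if it has no in-neighbours (out-neighbours). For a vertex $s$, $D-s$ is the digraph obtained by deleting $s$. Procedure $\mathrm{CS}(D=(V,A),F)$: (1) output $V$; (2) for each vertex $s\in V\setminus F$ that is a source or sink of $D$, in turn: call $\mathrm{CS}(D-s,F)$, and then set $F:=F\cup\{s\}$ (so later recursive calls in this loop use the enlarged $F$). -}

module Defs where

open import Data.Nat using (ℕ; zero; suc)
open import Data.Fin using (Fin)
open import Data.Bool using (Bool; true; false; if_then_else_; _∧_; _∨_; not)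
open import Data.List using (List; []; _∷_; _++_; allFin)
open import Data.Bool.ListAction using (any)
open import Data.Vec using (lookup)
open import Data.Fin.Subset using (Subset; _∈_; _-_; _∪_; ⁅_⁆; Nonempty)
open import Data.Product using (_×_)
open import Data.Empty using (⊥)
open import Relation.Binary.PropositionalEquality using (_≡_)

Digraph : ℕ → Set
Digraph n = Fin n → Fin n → Bool

module _ {n : ℕ} (D : Digraph n) where

  Arc : Fin n → Fin n → Set
  Arc u v = D u v ≡ true

  -- directed walks (in an acyclic digraph these are exactly directed paths)
  data Path : Fin n → Fin n → Set where
    here : ∀ {x} → Path x x
    step : ∀ {u v w} → Arc u v → Path v w → Path u w

  data OnPath (w : Fin n) : ∀ {x y} → Path x y → Set where
    start : ∀ {y} {p : Path w y} → OnPath w p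
    later : ∀ {u v y} {a : Arc u v} {p : Path v y} → OnPath w p → OnPath w (step a p)

  Acyclic : Set
  Acyclic = ∀ {x y} → Arc x y → Path y x → ⊥

  Convex : Subset n → Set
  Convex X = Nonempty X ×
    (∀ {u v} → u ∈ X → v ∈ X → (p : Path u v) → ∀ w → OnPath w p → w ∈ X)

  isSource : Subset n → Fin n → Bool
  isSource V s = not (any (λ u → lookup V u ∧ D u s) (allFin n))

  isSink : Subset n → Fin n → Bool
  isSink V s = not (any (λ u → lookup V u ∧ D s u) (allFin n))

  -- The current digraph is the induced subdigraph D[V].
  -- `ord V F` is the order in which the loop in step (2) visits vertices.
  -- The first ℕ argument is fuel, always equal to |V| when started from the
  -- full vertex set with fuel n (each recursive call deletes one vertex of V).
  module _ (ord : Subset n → Subset n → List (Fin n)) where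
    mutual
      CS : ℕ → Subset n → Subset n → List (Subset n)
      CS k V F = V ∷ loop k V F (ord V F)

      loop : ℕ → Subset n → Subset n → List (Fin n) → List (Subset n)
      loop zero    V F ss       = []
      loop (suc k) V F []       = []
      loop (suc k) V F (s ∷ ss) =
        if lookup V s ∧ not (lookup F s) ∧ (isSource V s ∨ isSink V s)
        then CS k (V - s) F ++ loop (suc k) V (F ∪ ⁅ s ⁆) ss
        else loop (suc k) V F ss

-- Deleting a source or a sink s from a vertex set V that contains every
-- directed path between its members keeps that property: a path between two
-- vertices of V - s that ran through s would enter s from (or leave s towards)
-- a vertex of V, which a source (sink) of D[V] does not allow. Every set
-- output by CS arises from the full vertex set by such deletions.
module Submission where

open import Defs
open import Data.Nat using (ℕ; zero; suc)
open import Data.Fin using (Fin; _≟_)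
open import Data.Fin.Subset using (Subset; ⊤; Nonempty; _∈_; _∉_; _─_; _-_; _∪_; ⁅_⁆; inside; outside)
open import Data.Fin.Subset.Properties using (∈⊤; p─q⊆p; x∈p∧x≢y⇒x∈p-y; x∉⁅y⁆⇒x≢y)
open import Data.Bool using (Bool; true; false; not; _∧_; _∨_; if_then_else_)
open import Data.Bool.ListAction using (any)
open import Data.Bool.Properties using (not-¬; T-≡; ∧-conicalʳ)
open import Data.List using (List; []; _∷_; allFin)
open import Data.List.Membership.Propositional using (lose) renaming (_∈_ to _∈ₗ_)
open import Data.List.Membership.Propositional.Properties using (∈-allFin)
open import Data.List.Relation.Binary.Permutation.Propositional using (_↭_)
open import Data.List.Relation.Unary.All as All using (All; []; _∷_)
open import Data.List.Relation.Unary.All.Properties using (++⁺)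
open import Data.List.Relation.Unary.Any.Properties using (any⁺)
open import Data.Vec using (_∷_; lookup; here; there)
open import Data.Vec.Properties using ([]=⇒lookup)
open import Data.Product using (_×_; _,_; ∃-syntax)
open import Function.Bundles using (Equivalence)
open import Function.Base using (_∘_)
open import Relation.Nullary using (¬_; yes; no; contradiction)
open import Relation.Binary.PropositionalEquality using (_≡_; _≢_; refl; sym; cong₂)

x∈p─q⇒x∉q : ∀ {n} {x : Fin n} (p q : Subset n) → x ∈ p ─ q → x ∉ q
x∈p─q⇒x∉q (inside  ∷ p) (inside ∷ q) ()            here
x∈p─q⇒x∉q (outside ∷ p) (inside ∷ q) ()            here
x∈p─q⇒x∉q (_       ∷ p) (_      ∷ q) (there x∈p─q) (there x∈q) =
  x∈p─q⇒x∉q p q x∈p─q x∈q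

x∈p-y⇒x≢y : ∀ {n} {x : Fin n} (p : Subset n) (y : Fin n) → x ∈ p - y → x ≢ y
x∈p-y⇒x≢y p y x∈p-y = x∉⁅y⁆⇒x≢y (x∈p─q⇒x∉q p ⁅ y ⁆ x∈p-y)

any-allFin : ∀ {n} (f : Fin n → Bool) (x : Fin n) → f x ≡ true → any f (allFin n) ≡ true
any-allFin f x fx = Equivalence.to T-≡ (any⁺ f (lose (∈-allFin x) (Equivalence.from T-≡ fx)))

module _ {n : ℕ} (D : Digraph n) where

  PathClosed : Subset n → Set
  PathClosed X = ∀ {u v} → u ∈ X → v ∈ X → (p : Path D u v) → ∀ w → OnPath D w p → w ∈ X

  OnPath-in-neighbour : ∀ {u v w} (p : Path D u v) → OnPath D w p → u ≢ w →
    ∃[ x ] Arc D x w × OnPath D x p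
  OnPath-in-neighbour p start u≢u = contradiction refl u≢u
  OnPath-in-neighbour {w = w} (step {v = v} u→v q) (later w∈q) u≢w with v ≟ w
  ... | yes refl = _ , u→v , start
  ... | no v≢w with OnPath-in-neighbour q w∈q v≢w
  ...   | x , x→w , x∈q = x , x→w , later x∈q

  OnPath-out-neighbour : ∀ {u v w} (p : Path D u v) → OnPath D w p → w ≢ v →
    ∃[ x ] Arc D w x × OnPath D x p
  OnPath-out-neighbour here         start       v≢v = contradiction refl v≢v
  OnPath-out-neighbour (step u→x q) start       _   = _ , u→x , later start
  OnPath-out-neighbour (step _ q)   (later w∈q) w≢v with OnPath-out-neighbour q w∈q w≢v
  ... | x , w→x , x∈q = x , w→x , later x∈q

  isSource⇒¬Arc : ∀ {V s u} → isSource D V s ≡ true → u ∈ V → ¬ Arc D u s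
  isSource⇒¬Arc {V} {s} {u} src u∈V u→s =
    not-¬ (sym (any-allFin (λ x → lookup V x ∧ D x s) u (cong₂ _∧_ ([]=⇒lookup u∈V) u→s))) (sym src)

  isSink⇒¬Arc : ∀ {V s u} → isSink D V s ≡ true → u ∈ V → ¬ Arc D s u
  isSink⇒¬Arc {V} {s} {u} snk u∈V s→u =
    not-¬ (sym (any-allFin (λ x → lookup V x ∧ D s x) u (cong₂ _∧_ ([]=⇒lookup u∈V) s→u))) (sym snk)

  module _ {V : Subset n} {s : Fin n} (closed : PathClosed V) where

    PathClosed-remove-source : isSource D V s ≡ true → PathClosed (V - s)
    PathClosed-remove-source src u∈ v∈ p w w∈p = x∈p∧x≢y⇒x∈p-y (closed (⊆V u∈) (⊆V v∈) p w w∈p) w≢s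
      where
      ⊆V = p─q⊆p V ⁅ s ⁆
      w≢s : w ≢ s
      w≢s refl with OnPath-in-neighbour p w∈p (x∈p-y⇒x≢y V s u∈)
      ... | x , x→s , x∈p = isSource⇒¬Arc src (closed (⊆V u∈) (⊆V v∈) p x x∈p) x→s

    PathClosed-remove-sink : isSink D V s ≡ true → PathClosed (V - s)
    PathClosed-remove-sink snk u∈ v∈ p w w∈p = x∈p∧x≢y⇒x∈p-y (closed (⊆V u∈) (⊆V v∈) p w w∈p) w≢s
      where
      ⊆V = p─q⊆p V ⁅ s ⁆
      w≢s : w ≢ s
      w≢s refl with OnPath-out-neighbour p w∈p (x∈p-y⇒x≢y V s v∈ ∘ sym)
      ... | x , s→x , x∈p = isSink⇒¬Arc snk (closed (⊆V u∈) (⊆V v∈) p x x∈p) s→x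

    PathClosed-remove : isSource D V s ∨ isSink D V s ≡ true → PathClosed (V - s)
    PathClosed-remove src∨snk with isSource D V s in src
    ... | true  = PathClosed-remove-source src
    ... | false = PathClosed-remove-sink src∨snk

All-if : ∀ {a} {A : Set a} {P : A → Set} {xs ys : List A} b →
  (b ≡ true → All P xs) → All P ys → All P (if b then xs else ys)
All-if true  Pxs _   = Pxs refl
All-if false _   Pys = Pys

module _ {n : ℕ} (D : Digraph n) (ord : Subset n → Subset n → List (Fin n))
         (P : Subset n → Set)
         (P-remove : ∀ {V s} → P V → isSource D V s ∨ isSink D V s ≡ true → P (V - s)) where

  mutual
    CS-invariant : ∀ k V F → P V → All P (CS D ord k V F)
    CS-invariant k V F PV = PV ∷ loop-invariant k V F (ord V F) PV

    loop-invariant : ∀ k V F ss → P V → All P (loop D ord k V F ss)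
    loop-invariant zero    V F ss       PV = []
    loop-invariant (suc k) V F []       PV = []
    loop-invariant (suc k) V F (s ∷ ss) PV =
      All-if (lookup V s ∧ not (lookup F s) ∧ (isSource D V s ∨ isSink D V s))
        (λ deletable →
          ++⁺ (CS-invariant k (V - s) F (P-remove PV (∧-conicalʳ _ _ (∧-conicalʳ (lookup V s) _ deletable))))
              (loop-invariant (suc k) V (F ∪ ⁅ s ⁆) ss PV))
        (loop-invariant (suc k) V F ss PV)

proposition10 : (n : ℕ) (D : Digraph n) → Acyclic D →
    (ord : Subset n → Subset n → List (Fin n)) →
    (∀ V F → ord V F ↭ allFin n) →
    (F : Subset n) (X : Subset n) →
    X ∈ₗ CS D ord n ⊤ F → Nonempty X → Convex D X
proposition10 n D _ ord _ F X X∈CS X≢∅ =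
  X≢∅ , All.lookup (CS-invariant D ord (PathClosed D) (PathClosed-remove D) n ⊤ F ⊤-closed) X∈CS
  where
  ⊤-closed : PathClosed D ⊤
  ⊤-closed _ _ _ _ _ = ∈⊤
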